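{- Let $D$ be a symmetric $(81,16,3)$ design (if one exists) and let $\alpha$ be an automorphism of $D$ of order $13$. Then $|F(\alpha)|=3$.
   Context: A symmetric $(v,k,\lambda)$ design, for integers $v>k>\lambda\geq 0$, is a pair $D=(V,\mathcal{B})$ where $V$ is a set of $v$ points and $\mathcal{B}$ is a set of $k$-subsets of $V$ (blocks) such that $|\mathcal{B}|=v$, every point lies in exactly $k$ blocks, any two distinct blocks meet in exactly $\lambda$ points, and any two distinct points lie in exactly $\lambda$ common blocks. An automorphism of $D$ is a permutation of $V$ mapping blocks to blocks. $F(\alpha)$ denotes the set of points fixed by $\alpha$. -}

module Defs where

open import Data.Nat using (ℕ; zero; suc; _<_; _>_)
open import Data.Fin using (Fin; _≟_)
open import Data.Fin.Subset using (Subset; _∈_; _∩_; ∣_∣)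
open import Data.Fin.Subset.Properties using (_∈?_)
open import Data.Fin.Permutation using (Permutation′; _⟨$⟩ʳ_; _⟨$⟩ˡ_)
open import Data.Vec using (Vec; tabulate; count; lookup)
open import Data.Product using (Σ; _×_; ∃)
open import Relation.Binary.PropositionalEquality using (_≡_; _≢_)
open import Relation.Nullary using (¬_; _×-dec_)
open import Function using (Injective; id; _∘_)

allFin : (n : ℕ) → Vec (Fin n) n
allFin n = tabulate id

-- A symmetric (v,k,λ) design (λ is written μ) with point set Fin v.  The block set 𝓑 is given
-- by an injective enumeration  block : Fin v → Subset v  (so 𝓑 consists of
-- exactly v distinct k-subsets).
record SymmetricDesign (v k μ : ℕ) : Set where
  field
    v>k          : v > k
    k>μ          : k > μ
    block        : Fin v → Subset v
    block-inj    : Injective _≡_ _≡_ block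
    block-size   : ∀ j → ∣ block j ∣ ≡ k
    point-degree : ∀ x → count (λ j → x ∈? block j) (allFin v) ≡ k
    block-meet   : ∀ i j → i ≢ j → ∣ block i ∩ block j ∣ ≡ μ
    point-pair   : ∀ x y → x ≢ y →
                   count (λ j → (x ∈? block j) ×-dec (y ∈? block j)) (allFin v) ≡ μ

open SymmetricDesign public

-- image of a point subset under a permutation: σ⟦ S ⟧ = { σ x | x ∈ S }
-- (y ∈ σ⟦ S ⟧ iff σ⁻¹ y ∈ S)
_⟦_⟧ : ∀ {n} → Permutation′ n → Subset n → Subset n
σ ⟦ S ⟧ = tabulate (λ y → lookup S (σ ⟨$⟩ˡ y))

IsAutomorphism : ∀ {v k μ} → SymmetricDesign v k μ → Permutation′ v → Set
IsAutomorphism {v} D σ = ∀ (j : Fin v) → ∃ λ (j′ : Fin v) → σ ⟦ block D j ⟧ ≡ block D j′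

_^_ : ∀ {n} → Permutation′ n → ℕ → Fin n → Fin n
σ ^ zero  = id
σ ^ suc m = (σ ⟨$⟩ʳ_) ∘ (σ ^ m)

IsIdentity : ∀ {n} → (Fin n → Fin n) → Set
IsIdentity f = ∀ x → f x ≡ x

HasOrder : ∀ {n} → Permutation′ n → ℕ → Set
HasOrder σ m = (0 < m) × IsIdentity (σ ^ m) × (∀ i → 0 < i → i < m → ¬ IsIdentity (σ ^ i))

numFixed : ∀ {n} → Permutation′ n → ℕ
numFixed {n} σ = count (λ x → (σ ⟨$⟩ʳ x) ≟ x) (allFin n)

module Submission where

-- Let α have prime order p > λ.  Its orbits on points and on blocks have size
-- 1 or p, so every α-invariant set has |moved part| ≡ 0 (mod p); in particular
-- |F(α)| ≡ v (mod p), and an invariant set with fewer than p elements is pointwise fixed.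
-- Applied to the λ blocks through two fixed points, resp. the λ points on two fixed blocks,
-- this shows: blocks through two fixed points are fixed, and points on two fixed blocks are
-- fixed.  Through a fixed point y pass k ≡ (number of fixed blocks through y) (mod p) blocks;
-- "all fixed" is impossible when α ≠ 1 (a moved point x would share two fixed blocks with y),
-- so when k ≤ λ + p at most λ fixed blocks pass through y.  Every other fixed point z then
-- lies on all of them (they contain the λ blocks through y and z), so all fixed points lie
-- on two distinct fixed blocks and |F(α)| ≤ λ.  For (81,16,3) and p = 13 this gives
-- |F(α)| ≤ 3 and |F(α)| ≡ 81 (mod 13), hence |F(α)| = 3.

open import Defs
open import Data.Fin.Permutation using (Permutation′; _⟨$⟩ʳ_; _⟨$⟩ˡ_; inverseˡ)
open import Relation.Binary.PropositionalEquality
  using (_≡_; _≢_; refl; sym; trans; cong; cong₂; subst; module ≡-Reasoning)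

import Algebra.Properties.CommutativeSemigroup
open import Data.Bool using (Bool; true; false; _∧_; _∨_; not)
open import Data.Bool.Properties using (∧-identityʳ; ∧-zeroʳ; ∧-conicalˡ; ∧-conicalʳ)
open import Data.Empty using (⊥-elim)
open import Data.Fin using (Fin; zero; suc; _≟_; toℕ; fromℕ<)
open import Data.Fin.Properties using (any?; suc-injective; toℕ-injective; toℕ<n; toℕ-fromℕ<; ¬∀⟶∃¬)
open import Data.Fin.Subset as Subset using (Subset; ∣_∣)
open import Data.Fin.Subset.Properties using (_∈?_)
open import Data.Nat using (ℕ; zero; suc; _+_; _*_; _∸_; _≤_; _<_; z≤n; s≤s; pred; NonZero; >-nonZero; >-nonZero⁻¹)
open import Data.Nat.Coprimality using (prime⇒coprime; coprime-Bézout)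
open import Data.Nat.DivMod using (_%_; _/_; m≡m%n+[m/n]*n; m%n<n)
open import Data.Nat.Divisibility using (_∣_; _∣?_; divides; _∣0; ∣-refl; ∣m∣n⇒∣m+n; ∣⇒≤)
open import Data.Nat.GCD using (module Bézout)
open import Data.Nat.GeneralisedArithmetic using (fold; fold-+)
open import Data.Nat.Induction using (<-rec)
open import Data.Nat.Primality using (Prime; prime?; prime⇒nonZero)
open import Data.Nat.Properties
  using ( +-commutativeSemigroup; ≤-refl; ≤-reflexive; ≤-trans; ≤-antisym; ≤-pred; <-irrefl; <-cmp
        ; module ≤-Reasoning; _<?_; _≤?_; +-comm; +-suc; +-identityʳ; +-mono-≤; +-monoʳ-≤; +-cancelʳ-≤
        ; m≤m+n; m≤n+m; m<n+m; m+n∸m≡n; m≤n⇒∃[o]m+o≡n; suc-pred )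
open import Data.Product using (∃; _×_; _,_; proj₁; proj₂)
open import Data.Sum using (_⊎_; inj₁; inj₂)
open import Data.Vec using (Vec; []; _∷_; lookup; tabulate; count)
open import Data.Vec.Properties using (lookup∘tabulate; tabulate∘lookup; tabulate-cong; lookup-zipWith)
open import Function using (_∘_; _$_; id; Injective; case_of_)
open import Induction.WellFounded using (WfRec)
open import Relation.Binary using (tri<; tri≈; tri>)
open import Relation.Nullary using (Dec; yes; no; does; _×-dec_)
open import Relation.Nullary.Decidable using (dec-true; dec-false; from-yes; from-no)
open import Relation.Nullary.Negation using (contradiction)

open Algebra.Properties.CommutativeSemigroup +-commutativeSemigroup using (interchange)

Pred𝔹 : ℕ → Set
Pred𝔹 n = Fin n → Bool

does-sound : ∀ {A : Set} (d : Dec A) → does d ≡ true → A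
does-sound (yes a) _ = a
does-sound (no _) ()

_==_ : ∀ {n} → Fin n → Fin n → Bool
x == y = does (x ≟ y)

≠-sound : ∀ {n} {a b : Fin n} → not (a == b) ≡ true → a ≢ b
≠-sound {a = a} a≠b refl rewrite dec-true (a ≟ a) refl = case a≠b of λ ()

∧-intro : ∀ {a b} → a ≡ true → b ≡ true → a ∧ b ≡ true
∧-intro refl refl = refl

_∩_ : ∀ {n} → Pred𝔹 n → Pred𝔹 n → Pred𝔹 n
(P ∩ Q) i = P i ∧ Q i

∁ : ∀ {n} → Pred𝔹 n → Pred𝔹 n
∁ P i = not (P i)

_⊆_ : ∀ {n} → Pred𝔹 n → Pred𝔹 n → Set
P ⊆ Q = ∀ i → P i ≡ true → Q i ≡ true

∩-⊆ˡ : ∀ {n} (P Q : Pred𝔹 n) → (P ∩ Q) ⊆ P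
∩-⊆ˡ P Q i = ∧-conicalˡ (P i) (Q i)

∩-⊆ʳ : ∀ {n} (P Q : Pred𝔹 n) → (P ∩ Q) ⊆ Q
∩-⊆ʳ P Q i = ∧-conicalʳ (P i) (Q i)

indicator : Bool → ℕ
indicator true  = 1
indicator false = 0

card : ∀ {n} → Pred𝔹 n → ℕ
card {zero}  P = 0
card {suc n} P = indicator (P zero) + card (P ∘ suc)

card-cong : ∀ {n} {P Q : Pred𝔹 n} → (∀ i → P i ≡ Q i) → card P ≡ card Q
card-cong {zero}  eq = refl
card-cong {suc n} eq = cong₂ _+_ (cong indicator (eq zero)) (card-cong (eq ∘ suc))

card-full : ∀ {n} → card {n} (λ _ → true) ≡ n
card-full {zero}  = refl
card-full {suc n} = cong suc (card-full {n})

card-mono : ∀ {n} {P Q : Pred𝔹 n} → P ⊆ Q → card P ≤ card Q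
card-mono {zero}          P⊆Q = z≤n
card-mono {suc n} {P} {Q} P⊆Q = +-mono-≤ (head (P zero) (Q zero) (P⊆Q zero)) (card-mono (P⊆Q ∘ suc))
  where
  head : ∀ a b → (a ≡ true → b ≡ true) → indicator a ≤ indicator b
  head true  b a⇒b rewrite a⇒b refl = ≤-refl
  head false b _   = z≤n

card-split : ∀ {n} (P Q : Pred𝔹 n) → card P ≡ card (P ∩ Q) + card (P ∩ ∁ Q)
card-split {zero}  P Q = refl
card-split {suc n} P Q = begin
  indicator (P zero) + card (P ∘ suc)
    ≡⟨ cong₂ _+_ (head (P zero) (Q zero)) (card-split (P ∘ suc) (Q ∘ suc)) ⟩
  (indicator (P zero ∧ Q zero) + indicator (P zero ∧ not (Q zero)))
    + (card ((P ∩ Q) ∘ suc) + card ((P ∩ ∁ Q) ∘ suc))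
    ≡⟨ interchange (indicator (P zero ∧ Q zero)) _ (card ((P ∩ Q) ∘ suc)) _ ⟩
  card (P ∩ Q) + card (P ∩ ∁ Q) ∎
  where
  open ≡-Reasoning
  head : ∀ a b → indicator a ≡ indicator (a ∧ b) + indicator (a ∧ not b)
  head true  true  = refl
  head true  false = refl
  head false b     = refl

card-remove : ∀ {n} (P : Pred𝔹 n) {a} → P a ≡ true → card P ≡ suc (card (P ∩ ∁ (_== a)))
card-remove {suc n} P {zero} Pa rewrite Pa =
  cong suc (card-cong (λ i → sym (∧-identityʳ (P (suc i)))))
card-remove {suc n} P {suc a} Pa = begin
  indicator (P zero) + card (P ∘ suc)                        ≡⟨ cong (indicator (P zero) +_) (card-remove (P ∘ suc) Pa) ⟩
  indicator (P zero) + suc (card ((P ∘ suc) ∩ ∁ (_== a)))    ≡⟨ +-suc (indicator (P zero)) _ ⟩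
  suc (indicator (P zero) + card ((P ∘ suc) ∩ ∁ (_== a)))    ≡⟨ cong (λ b → suc (indicator b + card ((P ∘ suc) ∩ ∁ (_== a)))) (sym (∧-identityʳ (P zero))) ⟩
  suc (card (P ∩ ∁ (_== suc a)))                              ∎
  where open ≡-Reasoning

card-positive : ∀ {n} (P : Pred𝔹 n) {a} → P a ≡ true → 0 < card P
card-positive P Pa rewrite card-remove P Pa = s≤s z≤n

card-witness : ∀ {n} (P : Pred𝔹 n) → 0 < card P → ∃ λ a → P a ≡ true
card-witness {suc n} P pos with P zero in P0
... | true  = zero , P0
... | false = let (a , Pa) = card-witness (P ∘ suc) pos in suc a , Pa

empty-or-witness : ∀ {n} (P : Pred𝔹 n) → card P ≡ 0 ⊎ ∃ λ a → P a ≡ true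
empty-or-witness P with card P in size
... | zero  = inj₁ refl
... | suc _ = inj₂ (card-witness P (subst (0 <_) (sym size) (s≤s z≤n)))

card-two : ∀ {n} (P : Pred𝔹 n) → 2 ≤ card P →
           ∃ λ a → ∃ λ b → a ≢ b × P a ≡ true × P b ≡ true
card-two P two≤ =
  let (a , a∈P)   = card-witness P (≤-trans (s≤s z≤n) two≤)
      (b , b∈P∖a) = card-witness (P ∩ ∁ (_== a)) (≤-pred (subst (2 ≤_) (card-remove P a∈P) two≤))
  in a , b , (λ a≡b → ≠-sound (∩-⊆ʳ P (∁ (_== a)) b b∈P∖a) (sym a≡b)) , a∈P , ∩-⊆ˡ P (∁ (_== a)) b b∈P∖a

card-injection : ∀ {m n} (P : Pred𝔹 n) (h : Fin m → Fin n) → Injective _≡_ _≡_ h →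
                 (∀ i → P (h i) ≡ true) → m ≤ card P
card-injection {zero}  P h h-inj h∈P = z≤n
card-injection {suc m} P h h-inj h∈P rewrite card-remove P (h∈P zero) =
  s≤s (card-injection _ (h ∘ suc) (λ e → suc-injective (h-inj e)) h∈P′)
  where
  h∈P′ : ∀ i → P (h (suc i)) ∧ not (h (suc i) == h zero) ≡ true
  h∈P′ i rewrite h∈P (suc i) | dec-false (h (suc i) ≟ h zero) (λ e → case h-inj e of λ ()) = refl

card-⊆-antisym : ∀ {n} {P Q : Pred𝔹 n} → P ⊆ Q → card Q ≤ card P → Q ⊆ P
card-⊆-antisym {P = P} {Q} P⊆Q Q≤P a Qa with P a in Pa
... | true  = refl
... | false = ⊥-elim $ <-irrefl refl (≤-trans (s≤s (card-mono P⊆Q∖a)) (subst (_≤ card P) (card-remove Q Qa) Q≤P))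
  where
  P⊆Q∖a : P ⊆ (Q ∩ ∁ (_== a))
  P⊆Q∖a i Pi with i ≟ a
  ... | yes refl = case trans (sym Pa) Pi of λ ()
  ... | no  _    rewrite P⊆Q i Pi = refl

_∪_ : ∀ {n} → Pred𝔹 n → Pred𝔹 n → Pred𝔹 n
(P ∪ Q) i = P i ∨ Q i

card-∪ : ∀ {n} (P Q : Pred𝔹 n) → card (P ∪ Q) ≤ card P + card Q
card-∪ {zero}  P Q = z≤n
card-∪ {suc n} P Q = begin
  indicator (P zero ∨ Q zero) + card ((P ∪ Q) ∘ suc)
    ≤⟨ +-mono-≤ (head (P zero) (Q zero)) (card-∪ (P ∘ suc) (Q ∘ suc)) ⟩
  (indicator (P zero) + indicator (Q zero)) + (card (P ∘ suc) + card (Q ∘ suc))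
    ≡⟨ interchange (indicator (P zero)) _ (card (P ∘ suc)) _ ⟩
  card P + card Q ∎
  where
  open ≤-Reasoning
  head : ∀ a b → indicator (a ∨ b) ≤ indicator a + indicator b
  head true  b = s≤s z≤n
  head false b = ≤-refl

card-empty : ∀ {n} → card {n} (λ _ → false) ≡ 0
card-empty {zero}  = refl
card-empty {suc n} = card-empty {n}

card-singleton : ∀ {n} (a : Fin n) → card (a ==_) ≡ 1
card-singleton {suc n} zero    = cong suc (card-empty {n})
card-singleton {suc n} (suc a) = card-singleton a

Image : ∀ {m n} → (Fin m → Fin n) → Pred𝔹 n
Image h y = does (any? λ i → h i ≟ y)

card-image : ∀ {m n} (h : Fin m → Fin n) → card (Image h) ≤ m
card-image {zero} {n} h = ≤-reflexive (card-empty {n})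
card-image {suc m} h = begin
  card (Image h)                          ≤⟨ card-∪ (h zero ==_) (Image (h ∘ suc)) ⟩
  card (h zero ==_) + card (Image (h ∘ suc)) ≤⟨ +-mono-≤ (≤-reflexive (card-singleton (h zero))) (card-image (h ∘ suc)) ⟩
  suc m ∎
  where open ≤-Reasoning

card-∩-⊆ : ∀ {n} {P Q : Pred𝔹 n} → Q ⊆ P → card (P ∩ Q) ≡ card Q
card-∩-⊆ {P = P} {Q} Q⊆P = card-cong pointwise
  where
  pointwise : ∀ i → P i ∧ Q i ≡ Q i
  pointwise i with Q i in Qi
  ... | true  = cong (_∧ true) (Q⊆P i Qi)
  ... | false = ∧-zeroʳ (P i)

-- Orbits of a permutation g of Fin n of prime order p (g^p = 1).  Every orbit has size 1 or
-- p, so an invariant set has a multiple of p moved elements.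
module Orbits {n} (g : Fin n → Fin n) (g-injective : Injective _≡_ _≡_ g)
              {p} (p-prime : Prime p) (g-period : ∀ x → fold x g p ≡ x) where

  private instance
    p-nonZero : NonZero p
    p-nonZero = prime⇒nonZero p-prime

  g^ : ℕ → Fin n → Fin n
  g^ k x = fold x g k

  g^-+ : ∀ i j x → g^ (i + j) x ≡ g^ i (g^ j x)
  g^-+ i j x = fold-+ x g i

  g^-cancel : ∀ i {x y} → g^ i x ≡ g^ i y → x ≡ y
  g^-cancel zero    e = e
  g^-cancel (suc i) e = g^-cancel i (g-injective e)

  period-multiple : ∀ {d x} → g^ d x ≡ x → ∀ t → g^ (t * d) x ≡ x
  period-multiple         e zero    = refl
  period-multiple {d} {x} e (suc t) = begin
    g^ (d + t * d) x      ≡⟨ g^-+ d (t * d) x ⟩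
    g^ d (g^ (t * d) x)   ≡⟨ cong (g^ d) (period-multiple e t) ⟩
    g^ d x                ≡⟨ e ⟩
    x                     ∎
    where open ≡-Reasoning

  g^-mod : ∀ k x → g^ k x ≡ g^ (k % p) x
  g^-mod k x = begin
    g^ k x                                ≡⟨ cong (λ m → g^ m x) (m≡m%n+[m/n]*n k p) ⟩
    g^ (k % p + (k / p) * p) x            ≡⟨ g^-+ (k % p) _ x ⟩
    g^ (k % p) (g^ ((k / p) * p) x)       ≡⟨ cong (g^ (k % p)) (period-multiple (g-period x) (k / p)) ⟩
    g^ (k % p) x                          ∎
    where open ≡-Reasoning

  unit-combination-fixed : ∀ {x q r} s t → g^ q x ≡ x → g^ r x ≡ x →
                           1 + s * q ≡ t * r → g x ≡ x
  unit-combination-fixed {x} s t q-period r-period eq = begin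
    g x                   ≡⟨ cong g (sym (period-multiple q-period s)) ⟩
    g^ (1 + s * _) x      ≡⟨ cong (λ m → g^ m x) eq ⟩
    g^ (t * _) x          ≡⟨ period-multiple r-period t ⟩
    x                     ∎
    where open ≡-Reasoning

  -- since p is prime, a period 0 < d < p is coprime to p; by Bézout, x is fixed
  short-period-fixed : ∀ {d x} → 0 < d → d < p → g^ d x ≡ x → g x ≡ x
  short-period-fixed {suc d} {x} _ d<p d-period
    with coprime-Bézout (prime⇒coprime p-prime d<p)
  ... | Bézout.+- s t eq = unit-combination-fixed t s d-period (g-period x) eq
  ... | Bézout.-+ s t eq = unit-combination-fixed s t (g-period x) d-period eq

  Fixed : Pred𝔹 n
  Fixed x = g x == x

  Moved : Pred𝔹 n
  Moved = ∁ Fixed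

  fixed⇒≡ : ∀ {x} → Fixed x ≡ true → g x ≡ x
  fixed⇒≡ {x} = does-sound (g x ≟ x)

  ≡⇒fixed : ∀ {x} → g x ≡ x → Fixed x ≡ true
  ≡⇒fixed {x} = dec-true (g x ≟ x)

  moved⇒≢ : ∀ {x} → Moved x ≡ true → g x ≢ x
  moved⇒≢ {x} mx gx≡x rewrite dec-true (g x ≟ x) gx≡x = case mx of λ ()

  ≢⇒moved : ∀ {x} → g x ≢ x → Moved x ≡ true
  ≢⇒moved {x} gx≢x rewrite dec-false (g x ≟ x) gx≢x = refl

  return-fixed : ∀ {x a b} → a < b → b < p → g^ a x ≡ g^ b x → g x ≡ x
  return-fixed {x} {a} a<b b<p e with m≤n⇒∃[o]m+o≡n a<b
  ... | o , refl = short-period-fixed (s≤s z≤n) (≤-trans (s≤s (s≤s (m≤n+m o a))) b<p)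
                     (sym (g^-cancel a shifted))
    where
    shifted : g^ a x ≡ g^ a (g^ (suc o) x)
    shifted = begin
      g^ a x                   ≡⟨ e ⟩
      g^ (suc (a + o)) x       ≡⟨ cong (λ m → g^ m x) (+-suc a o) ⟨
      g^ (a + suc o) x         ≡⟨ g^-+ a (suc o) x ⟩
      g^ a (g^ (suc o) x)      ∎
      where open ≡-Reasoning

  orbit : Fin n → Fin p → Fin n
  orbit x i = g^ (toℕ i) x

  orbit-injective : ∀ {x} → g x ≢ x → Injective _≡_ _≡_ (orbit x)
  orbit-injective {x} moved {i} {j} e with <-cmp (toℕ i) (toℕ j)
  ... | tri≈ _ i≡j _ = toℕ-injective i≡j
  ... | tri< i<j _ _ = ⊥-elim (moved (return-fixed i<j (toℕ<n j) e))
  ... | tri> _ _ j<i = ⊥-elim (moved (return-fixed j<i (toℕ<n i) (sym e)))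

  Orbit : Fin n → Pred𝔹 n
  Orbit x = Image (orbit x)

  orbit-size : ∀ {x} → g x ≢ x → card (Orbit x) ≡ p
  orbit-size {x} moved = ≤-antisym (card-image (orbit x))
    (card-injection (Orbit x) (orbit x) (orbit-injective moved) λ i → dec-true (any? _) (i , refl))

  iterate∈orbit : ∀ k x → Orbit x (g^ k x) ≡ true
  iterate∈orbit k x = dec-true (any? _) (fromℕ< (m%n<n k p) , (begin
    g^ (toℕ (fromℕ< (m%n<n k p))) x   ≡⟨ cong (λ m → g^ m x) (toℕ-fromℕ< (m%n<n k p)) ⟩
    g^ (k % p) x                       ≡⟨ g^-mod k x ⟨
    g^ k x                             ∎))
    where open ≡-Reasoning

  orbit⇒iterate : ∀ {x y} → Orbit x y ≡ true → ∃ λ k → g^ k x ≡ y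
  orbit⇒iterate {x} {y} e = let (i , eq) = does-sound (any? λ i → orbit x i ≟ y) e in toℕ i , eq

  g^pred-inverse : ∀ y → g^ (pred p) (g y) ≡ y
  g^pred-inverse y = begin
    g^ (pred p) (g y)     ≡⟨ g^-+ (pred p) 1 y ⟨
    g^ (pred p + 1) y     ≡⟨ cong (λ m → g^ m y) (trans (+-comm (pred p) 1) (suc-pred p)) ⟩
    g^ p y                ≡⟨ g-period y ⟩
    y                     ∎
    where open ≡-Reasoning

  orbit-backward : ∀ {x y} → Orbit x (g y) ≡ true → Orbit x y ≡ true
  orbit-backward {x} {y} e with orbit⇒iterate e
  ... | k , gᵏx≡gy = subst (λ z → Orbit x z ≡ true) (begin
    g^ (pred p + k) x        ≡⟨ g^-+ (pred p) k x ⟩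
    g^ (pred p) (g^ k x)     ≡⟨ cong (g^ (pred p)) gᵏx≡gy ⟩
    g^ (pred p) (g y)        ≡⟨ g^pred-inverse y ⟩
    y                        ∎) (iterate∈orbit (pred p + k) x)
    where open ≡-Reasoning

  Invariant : Pred𝔹 n → Set
  Invariant S = ∀ y → S y ≡ true → S (g y) ≡ true

  invariant-iterate : ∀ {S x} → Invariant S → S x ≡ true → ∀ k → S (g^ k x) ≡ true
  invariant-iterate inv Sx zero    = Sx
  invariant-iterate inv Sx (suc k) = inv _ (invariant-iterate inv Sx k)

  orbit-⊆ : ∀ {S x} → Invariant S → S x ≡ true → Orbit x ⊆ S
  orbit-⊆ {S} inv Sx y y∈orbit with orbit⇒iterate y∈orbit
  ... | k , refl = invariant-iterate inv Sx k

  moved-invariant : Invariant Moved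
  moved-invariant y my = ≢⇒moved (λ e → moved⇒≢ my (g-injective e))

  ∩-invariant : ∀ {S T} → Invariant S → Invariant T → Invariant (S ∩ T)
  ∩-invariant {S} {T} invS invT y STy =
    ∧-intro (invS y (∩-⊆ˡ S T y STy)) (invT y (∩-⊆ʳ S T y STy))

  outside-orbit-invariant : ∀ x → Invariant (∁ (Orbit x))
  outside-orbit-invariant x y y∉ with Orbit x (g y) in gy∈
  ... | true  = case subst (λ b → not b ≡ true) (orbit-backward gy∈) y∉ of λ ()
  ... | false = refl

  -- an invariant set of moved points is a disjoint union of orbits of size p;
  -- by strong induction on its size, remove one orbit at a time
  moved-set-multiple : ∀ {S} → Invariant S → S ⊆ Moved → p ∣ card S
  moved-set-multiple {S} = <-rec Goal step (card S) refl
    where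
    Goal : ℕ → Set
    Goal c = ∀ {S} → card S ≡ c → Invariant S → S ⊆ Moved → p ∣ card S

    step : ∀ c → WfRec _<_ Goal c → Goal c
    step _ rec {S} refl inv ⊆moved with empty-or-witness S
    ... | inj₁ empty        = subst (p ∣_) (sym empty) (p ∣0)
    ... | inj₂ (a , a∈S) = subst (p ∣_) (sym split) (∣m∣n⇒∣m+n ∣-refl rest-multiple)
      where
      rest : Pred𝔹 n
      rest = S ∩ ∁ (Orbit a)
      split : card S ≡ p + card rest
      split = begin
        card S                                 ≡⟨ card-split S (Orbit a) ⟩
        card (S ∩ Orbit a) + card rest         ≡⟨ cong (_+ card rest) (card-∩-⊆ (orbit-⊆ inv a∈S)) ⟩
        card (Orbit a) + card rest             ≡⟨ cong (_+ card rest) (orbit-size (moved⇒≢ (⊆moved a a∈S))) ⟩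
        p + card rest                          ∎
        where open ≡-Reasoning
      rest-smaller : card rest < card S
      rest-smaller = subst (card rest <_) (sym split) (m<n+m (card rest) (>-nonZero⁻¹ p))
      rest-multiple : p ∣ card rest
      rest-multiple = rec rest-smaller {rest} refl (∩-invariant inv (outside-orbit-invariant a))
                        (λ y e → ⊆moved y (∩-⊆ˡ S (∁ (Orbit a)) y e))

  moved-multiple : ∀ {S} → Invariant S → p ∣ card (S ∩ Moved)
  moved-multiple inv = moved-set-multiple (∩-invariant inv moved-invariant) (∩-⊆ʳ _ Moved)

  fixed-count-mod : p ∣ n ∸ card Fixed
  fixed-count-mod = subst (p ∣_) moved-count (moved-multiple {λ _ → true} (λ _ _ → refl))
    where
    moved-count : card Moved ≡ n ∸ card Fixed
    moved-count = begin
      card Moved                          ≡⟨ m+n∸m≡n (card Fixed) (card Moved) ⟨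
      card Fixed + card Moved ∸ card Fixed ≡⟨ cong (_∸ card Fixed) (card-split (λ _ → true) Fixed) ⟨
      card {n} (λ _ → true) ∸ card Fixed  ≡⟨ cong (_∸ card Fixed) card-full ⟩
      n ∸ card Fixed                      ∎
      where open ≡-Reasoning

  small-invariant-fixed : ∀ {S} → Invariant S → card S < p → ∀ {y} → S y ≡ true → g y ≡ y
  small-invariant-fixed {S} inv small {y} Sy with g y ≟ y
  ... | yes fixed = fixed
  ... | no  moved = ⊥-elim (<-irrefl refl (begin-strict
    p                     ≤⟨ ∣⇒≤ {{>-nonZero positive}} (moved-multiple inv) ⟩
    card (S ∩ Moved)      ≤⟨ card-mono (∩-⊆ˡ S Moved) ⟩
    card S                <⟨ small ⟩
    p                     ∎))
    where
    open ≤-Reasoning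
    positive : 0 < card (S ∩ Moved)
    positive = card-positive (S ∩ Moved) (∧-intro Sy (≢⇒moved moved))

lookup-ext : ∀ {A : Set} {n} (u w : Vec A n) → (∀ i → lookup u i ≡ lookup w i) → u ≡ w
lookup-ext u w eq = trans (sym (tabulate∘lookup u)) (trans (tabulate-cong eq) (tabulate∘lookup w))

count-tabulate : ∀ {A : Set} {P : A → Set} (P? : ∀ a → Dec (P a)) {n} (f : Fin n → A) →
                 count P? (tabulate f) ≡ card (λ i → does (P? (f i)))
count-tabulate P? {zero}  f = refl
count-tabulate P? {suc n} f with does (P? (f zero))
... | true  = cong suc (count-tabulate P? (f ∘ suc))
... | false = count-tabulate P? (f ∘ suc)

does-∈? : ∀ {n} x (S : Subset n) → does (x ∈? S) ≡ lookup S x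
does-∈? zero    (true  ∷ S) = refl
does-∈? zero    (false ∷ S) = refl
does-∈? (suc x) (_ ∷ S)     = does-∈? x S

size-card : ∀ {n} (S : Subset n) → ∣ S ∣ ≡ card (lookup S)
size-card []          = refl
size-card (true  ∷ S) = cong suc (size-card S)
size-card (false ∷ S) = size-card S

module Incidence {v k μ} (D : SymmetricDesign v k μ) where

  Points : Fin v → Pred𝔹 v
  Points j = lookup (block D j)

  Through : Fin v → Pred𝔹 v
  Through x j = Points j x

  through-size : ∀ x → card (Through x) ≡ k
  through-size x = begin
    card (Through x)                            ≡⟨ card-cong (λ j → does-∈? x (block D j)) ⟨
    card (λ j → does (x ∈? block D j))          ≡⟨ count-tabulate (λ j → x ∈? block D j) id ⟨
    count (λ j → x ∈? block D j) (allFin v)     ≡⟨ point-degree D x ⟩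
    k                                           ∎
    where open ≡-Reasoning

  pair-size : ∀ {x y} → x ≢ y → card (Through x ∩ Through y) ≡ μ
  pair-size {x} {y} x≢y = begin
    card (Through x ∩ Through y)
      ≡⟨ card-cong (λ j → cong₂ _∧_ (does-∈? x (block D j)) (does-∈? y (block D j))) ⟨
    card (λ j → does ((x ∈? block D j) ×-dec (y ∈? block D j)))
      ≡⟨ count-tabulate (λ j → (x ∈? block D j) ×-dec (y ∈? block D j)) id ⟨
    count (λ j → (x ∈? block D j) ×-dec (y ∈? block D j)) (allFin v)
      ≡⟨ point-pair D x y x≢y ⟩
    μ ∎
    where open ≡-Reasoning

  meet-size : ∀ {i j} → i ≢ j → card (Points i ∩ Points j) ≡ μ
  meet-size {i} {j} i≢j = begin
    card (Points i ∩ Points j)                ≡⟨ card-cong (λ x → lookup-zipWith _∧_ x (block D i) (block D j)) ⟨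
    card (lookup (block D i Subset.∩ block D j)) ≡⟨ size-card (block D i Subset.∩ block D j) ⟨
    ∣ block D i Subset.∩ block D j ∣          ≡⟨ block-meet D i j i≢j ⟩
    μ                                         ∎
    where open ≡-Reasoning

module Automorphism {v k μ} (D : SymmetricDesign v k μ) (α : Permutation′ v) (α-aut : IsAutomorphism D α)
                    {p} (p-prime : Prime p) (α-period : IsIdentity (α ^ p)) (μ<p : μ < p) where

  open Incidence D

  onPoints : Fin v → Fin v
  onPoints x = α ⟨$⟩ʳ x

  onBlocks : Fin v → Fin v
  onBlocks j = proj₁ (α-aut j)

  incidence-preserved : ∀ j x → Points (onBlocks j) (onPoints x) ≡ Points j x
  incidence-preserved j x = begin
    lookup (block D (onBlocks j)) (onPoints x)     ≡⟨ cong (λ B → lookup B (onPoints x)) (proj₂ (α-aut j)) ⟨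
    lookup (α ⟦ block D j ⟧) (onPoints x)          ≡⟨ lookup∘tabulate _ (onPoints x) ⟩
    lookup (block D j) (α ⟨$⟩ˡ (α ⟨$⟩ʳ x))         ≡⟨ cong (lookup (block D j)) (inverseˡ α) ⟩
    lookup (block D j) x                           ∎
    where open ≡-Reasoning

  -- both maps are injective and have order dividing p; for blocks this holds because
  -- distinct blocks have distinct point sets
  onPoints-injective : Injective _≡_ _≡_ onPoints
  onPoints-injective e = trans (sym (inverseˡ α)) (trans (cong (α ⟨$⟩ˡ_) e) (inverseˡ α))

  onBlocks-injective : Injective _≡_ _≡_ onBlocks
  onBlocks-injective {i} {j} e = block-inj D (lookup-ext _ _ λ x → begin
    Points i x                              ≡⟨ incidence-preserved i x ⟨
    Points (onBlocks i) (onPoints x)        ≡⟨ cong (λ b → Points b (onPoints x)) e ⟩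
    Points (onBlocks j) (onPoints x)        ≡⟨ incidence-preserved j x ⟩
    Points j x                              ∎)
    where open ≡-Reasoning

  onPoints-period : ∀ x → fold x onPoints p ≡ x
  onPoints-period x = trans (sym (power-fold p)) (α-period x)
    where
    power-fold : ∀ m → (α ^ m) x ≡ fold x onPoints m
    power-fold zero    = refl
    power-fold (suc m) = cong onPoints (power-fold m)

  iterate-incidence : ∀ m j x → Points (fold j onBlocks m) (fold x onPoints m) ≡ Points j x
  iterate-incidence zero    j x = refl
  iterate-incidence (suc m) j x =
    trans (incidence-preserved (fold j onBlocks m) (fold x onPoints m)) (iterate-incidence m j x)

  onBlocks-period : ∀ j → fold j onBlocks p ≡ j
  onBlocks-period j = block-inj D (lookup-ext _ _ λ x → begin
    Points (fold j onBlocks p) x                          ≡⟨ cong (Points (fold j onBlocks p)) (onPoints-period x) ⟨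
    Points (fold j onBlocks p) (fold x onPoints p)        ≡⟨ iterate-incidence p j x ⟩
    Points j x                                            ∎)
    where open ≡-Reasoning

  module Pt = Orbits onPoints onPoints-injective p-prime onPoints-period
  module Bl = Orbits onBlocks onBlocks-injective p-prime onBlocks-period

  through-invariant : ∀ {y} → onPoints y ≡ y → Bl.Invariant (Through y)
  through-invariant {y} fixed j y∈j = begin
    Points (onBlocks j) y                  ≡⟨ cong (Points (onBlocks j)) fixed ⟨
    Points (onBlocks j) (onPoints y)       ≡⟨ incidence-preserved j y ⟩
    Points j y                             ≡⟨ y∈j ⟩
    true                                   ∎
    where open ≡-Reasoning

  points-invariant : ∀ {j} → onBlocks j ≡ j → Pt.Invariant (Points j)
  points-invariant {j} fixed x x∈j = begin
    Points j (onPoints x)                  ≡⟨ cong (λ b → Points b (onPoints x)) fixed ⟨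
    Points (onBlocks j) (onPoints x)       ≡⟨ incidence-preserved j x ⟩
    Points j x                             ≡⟨ x∈j ⟩
    true                                   ∎
    where open ≡-Reasoning

  -- every block through two fixed points is fixed: they lie on only μ < p common blocks
  common-blocks-fixed : ∀ {y z} → y ≢ z → onPoints y ≡ y → onPoints z ≡ z →
                        ∀ {j} → (Through y ∩ Through z) j ≡ true → onBlocks j ≡ j
  common-blocks-fixed y≢z y-fixed z-fixed =
    Bl.small-invariant-fixed (Bl.∩-invariant (through-invariant y-fixed) (through-invariant z-fixed))
                             (subst (_< p) (sym (pair-size y≢z)) μ<p)

  common-points-fixed : ∀ {i j} → i ≢ j → onBlocks i ≡ i → onBlocks j ≡ j →
                        ∀ {x} → (Points i ∩ Points j) x ≡ true → onPoints x ≡ x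
  common-points-fixed i≢j i-fixed j-fixed =
    Pt.small-invariant-fixed (Pt.∩-invariant (points-invariant i-fixed) (points-invariant j-fixed))
                             (subst (_< p) (sym (meet-size i≢j)) μ<p)

  FixedThrough : Fin v → Pred𝔹 v
  FixedThrough y = Through y ∩ Bl.Fixed

  -- the non-fixed blocks through a fixed point form orbits of size p,
  -- so either all k blocks through it are fixed or at most k - p are
  fixed-blocks-through : ∀ {y} → onPoints y ≡ y →
                         card (FixedThrough y) ≡ k ⊎ card (FixedThrough y) + p ≤ k
  fixed-blocks-through {y} y-fixed = by-moved-count (Bl.moved-multiple (through-invariant y-fixed))
    where
    c : ℕ
    c = card (FixedThrough y)
    total : c + card (Through y ∩ Bl.Moved) ≡ k
    total = trans (sym (card-split (Through y) Bl.Fixed)) (through-size y)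
    by-moved-count : p ∣ card (Through y ∩ Bl.Moved) → c ≡ k ⊎ c + p ≤ k
    by-moved-count (divides zero    none)   = inj₁ (trans (sym (+-identityʳ c)) (trans (cong (c +_) (sym none)) total))
    by-moved-count (divides (suc q) orbits) = inj₂ (begin
      c + p                               ≤⟨ +-monoʳ-≤ c (m≤m+n p (q * p)) ⟩
      c + (p + q * p)                     ≡⟨ cong (c +_) orbits ⟨
      c + card (Through y ∩ Bl.Moved)     ≡⟨ total ⟩
      k                                   ∎)
      where open ≤-Reasoning

  -- if some point x is moved, some block through a fixed point y is moved: otherwise
  -- x and y would lie on two common blocks, both fixed, forcing x to be fixed
  not-all-blocks-fixed : 2 ≤ μ → ∀ {x y} → onPoints x ≢ x → onPoints y ≡ y → card (FixedThrough y) ≢ k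
  not-all-blocks-fixed 2≤μ {x} {y} x-moved y-fixed all-fixed =
    let (i , j , i≢j , i∈ , j∈) = card-two (Through x ∩ Through y) two-common
    in x-moved (common-points-fixed i≢j (common-fixed i∈) (common-fixed j∈) (∧-intro (on-x i i∈) (on-x j j∈)))
    where
    two-common : 2 ≤ card (Through x ∩ Through y)
    two-common = subst (2 ≤_) (sym (pair-size λ { refl → x-moved y-fixed })) 2≤μ
    on-x : (Through x ∩ Through y) ⊆ Through x
    on-x = ∩-⊆ˡ (Through x) (Through y)
    through-y-fixed : Through y ⊆ FixedThrough y
    through-y-fixed = card-⊆-antisym (∩-⊆ˡ (Through y) Bl.Fixed)
                        (≤-reflexive (trans (through-size y) (sym all-fixed)))
    common-fixed : ∀ {b} → (Through x ∩ Through y) b ≡ true → onBlocks b ≡ b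
    common-fixed {b} b∈ = Bl.fixed⇒≡ (∩-⊆ʳ (Through y) Bl.Fixed b
                            (through-y-fixed b (∩-⊆ʳ (Through x) (Through y) b b∈)))

  common-⊆-fixed-through : ∀ {y z} → y ≢ z → onPoints y ≡ y → onPoints z ≡ z →
                           (Through y ∩ Through z) ⊆ FixedThrough y
  common-⊆-fixed-through {y} {z} y≢z y-fixed z-fixed b b∈ =
    ∧-intro (∩-⊆ˡ (Through y) (Through z) b b∈) (Bl.≡⇒fixed (common-blocks-fixed y≢z y-fixed z-fixed b∈))

  -- if at most μ fixed blocks pass through the fixed point y, then they pass through
  -- every other fixed point z, as they contain the μ blocks through y and z
  shared-fixed-blocks : ∀ {y} → onPoints y ≡ y → card (FixedThrough y) ≤ μ →
                        ∀ {z} → z ≢ y → onPoints z ≡ z → FixedThrough y ⊆ Through z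
  shared-fixed-blocks {y} y-fixed few {z} z≢y z-fixed j j∈ =
    ∩-⊆ʳ (Through y) (Through z) j
      (card-⊆-antisym (common-⊆-fixed-through y≢z y-fixed z-fixed)
                      (subst (card (FixedThrough y) ≤_) (sym (pair-size y≢z)) few) j j∈)
    where
    y≢z : y ≢ z
    y≢z = z≢y ∘ sym

  -- with a second fixed point, all fixed points lie on two distinct fixed blocks through y,
  -- which meet in μ points
  fixed-points-on-two-blocks : 2 ≤ μ → ∀ {y} → onPoints y ≡ y → card (FixedThrough y) ≤ μ →
                               ∀ {z} → z ≢ y → onPoints z ≡ z → card Pt.Fixed ≤ μ
  fixed-points-on-two-blocks 2≤μ {y} y-fixed few {z} z≢y z-fixed =
    let (i , j , i≢j , i∈ , j∈) = card-two (FixedThrough y) two-fixed-blocks in begin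
      card Pt.Fixed                ≤⟨ card-mono (fixed-on i∈ j∈) ⟩
      card (Points i ∩ Points j)   ≡⟨ meet-size i≢j ⟩
      μ                            ∎
    where
    open ≤-Reasoning
    two-fixed-blocks : 2 ≤ card (FixedThrough y)
    two-fixed-blocks = ≤-trans 2≤μ (subst (_≤ card (FixedThrough y)) (pair-size (z≢y ∘ sym))
                         (card-mono (common-⊆-fixed-through (z≢y ∘ sym) y-fixed z-fixed)))
    fixed-on : ∀ {i j} → FixedThrough y i ≡ true → FixedThrough y j ≡ true → Pt.Fixed ⊆ (Points i ∩ Points j)
    fixed-on {i} {j} i∈ j∈ w w-fixed with w ≟ y
    ... | yes refl = ∧-intro (∩-⊆ˡ (Through y) Bl.Fixed i i∈) (∩-⊆ˡ (Through y) Bl.Fixed j j∈)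
    ... | no  w≢y  = ∧-intro (shared i i∈) (shared j j∈)
      where
      shared : FixedThrough y ⊆ Through w
      shared = shared-fixed-blocks y-fixed few w≢y (Pt.fixed⇒≡ w-fixed)

  few-fixed-blocks : k ≤ μ + p → 2 ≤ μ → ∀ {x y} → onPoints x ≢ x → onPoints y ≡ y →
                     card (FixedThrough y) ≤ μ
  few-fixed-blocks k≤μ+p 2≤μ x-moved y-fixed with fixed-blocks-through y-fixed
  ... | inj₁ all-fixed = ⊥-elim (not-all-blocks-fixed 2≤μ x-moved y-fixed all-fixed)
  ... | inj₂ c+p≤k     = +-cancelʳ-≤ p _ _ (≤-trans c+p≤k k≤μ+p)

  fixed-points-bound : k ≤ μ + p → 2 ≤ μ → ∀ {x} → onPoints x ≢ x → card Pt.Fixed ≤ μ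
  fixed-points-bound k≤μ+p 2≤μ x-moved with empty-or-witness Pt.Fixed
  ... | inj₁ no-fixed     = subst (_≤ μ) (sym no-fixed) z≤n
  ... | inj₂ (y , y-fixed) with empty-or-witness (Pt.Fixed ∩ ∁ (_== y))
  ...   | inj₁ only-y = subst (_≤ μ) (sym (trans (card-remove Pt.Fixed y-fixed) (cong suc only-y)))
                              (≤-trans (s≤s z≤n) 2≤μ)
  ...   | inj₂ (z , z-fixed∖y) =
    fixed-points-on-two-blocks 2≤μ (Pt.fixed⇒≡ y-fixed) (few-fixed-blocks k≤μ+p 2≤μ x-moved (Pt.fixed⇒≡ y-fixed))
                               (≠-sound (∩-⊆ʳ Pt.Fixed (∁ (_== y)) z z-fixed∖y))
                               (Pt.fixed⇒≡ (∩-⊆ˡ Pt.Fixed (∁ (_== y)) z z-fixed∖y))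

  numFixed-card : numFixed α ≡ card Pt.Fixed
  numFixed-card = count-tabulate (λ x → onPoints x ≟ x) id

fixed-count-81-13 : ∀ f → f ≤ 3 → 13 ∣ 81 ∸ f → f ≡ 3
fixed-count-81-13 0 _ 13∣81 = contradiction 13∣81 (from-no (13 ∣? 81))
fixed-count-81-13 1 _ 13∣80 = contradiction 13∣80 (from-no (13 ∣? 80))
fixed-count-81-13 2 _ 13∣79 = contradiction 13∣79 (from-no (13 ∣? 79))
fixed-count-81-13 3 _ _     = refl
fixed-count-81-13 (suc (suc (suc (suc _)))) (s≤s (s≤s (s≤s ()))) _

lemma3p5 : (D : SymmetricDesign 81 16 3) (α : Permutation′ 81) →
           IsAutomorphism D α → HasOrder α 13 → numFixed α ≡ 3
lemma3p5 D α α-aut (_ , α¹³≡id , smaller-powers) = begin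
  numFixed α      ≡⟨ numFixed-card ⟩
  card Pt.Fixed   ≡⟨ fixed-count-81-13 _ at-most-three Pt.fixed-count-mod ⟩
  3               ∎
  where
  open ≡-Reasoning
  open Automorphism D α α-aut (from-yes (prime? 13)) α¹³≡id (from-yes (3 <? 13))
  -- α has order 13, so α¹ is not the identity
  moved-point : ∃ λ x → onPoints x ≢ x
  moved-point = ¬∀⟶∃¬ 81 (λ x → onPoints x ≡ x) (λ x → onPoints x ≟ x) (smaller-powers 1 (s≤s z≤n) (from-yes (1 <? 13)))
  -- here k = 16 = λ + p and λ = 3 ≥ 2
  at-most-three : card Pt.Fixed ≤ 3
  at-most-three = fixed-points-bound ≤-refl (from-yes (2 ≤? 3)) (proj₂ moved-point)
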